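{- Let $\mathcal{A}$ be a $\dagger$-kernel category with finite complemented $\dagger$-biproducts, and let $f:X\to X$ be normal, i.e. $f^\dagger\circ f=f\circ f^\dagger$. Then $f$ is of the form $f_1\oplus 0:K\oplus\overline{K}\to K\oplus\overline{K}$ (under an isomorphism $X\cong K\oplus\overline{K}$) for some zero-epi $f_1:K\to K$.
   Context: A $\dagger$-kernel category is a $\dagger$-category with a zero object in which every morphism $f:X\to Y$ has a kernel $k:K\to X$ (equaliser of $f$ and $0$) with $k^\dagger\circ k=\mathrm{id}_K$; such morphisms $k$ are called $\dagger$-kernels. Finite $\dagger$-biproducts: biproducts whose coprojections and projections satisfy $\kappa_i^\dagger=\pi_i$. They are complemented if for every $\dagger$-kernel $k:X\to Y$ there is an object $\overline{X}$ with $Y\cong X\oplus\overline{X}$ such that $k$ is the first coprojection. A morphism $f:X\to Y$ is zero-epi if for every $g:Y\to Z$, $g\circ f=0$ implies $g=0$. -}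

module Defs where

open import Level using (Level; _⊔_; suc)
open import Data.Product using (Σ; Σ-syntax; _×_; _,_)
open import Relation.Binary using (IsEquivalence)

record Category (o ℓ e : Level) : Set (suc (o ⊔ ℓ ⊔ e)) where
  infixr 9 _∘_
  infix  4 _≈_
  field
    Obj   : Set o
    _⇒_   : Obj → Obj → Set ℓ
    _≈_   : ∀ {A B} → A ⇒ B → A ⇒ B → Set e
    id    : ∀ {A} → A ⇒ A
    _∘_   : ∀ {A B C} → B ⇒ C → A ⇒ B → A ⇒ C
    ≈-equiv   : ∀ {A B} → IsEquivalence (_≈_ {A} {B})
    ∘-resp-≈  : ∀ {A B C} {f h : B ⇒ C} {g i : A ⇒ B} →
                f ≈ h → g ≈ i → f ∘ g ≈ h ∘ i
    assoc     : ∀ {A B C D} {f : A ⇒ B} {g : B ⇒ C} {h : C ⇒ D} →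
                (h ∘ g) ∘ f ≈ h ∘ (g ∘ f)
    identityˡ : ∀ {A B} {f : A ⇒ B} → id ∘ f ≈ f
    identityʳ : ∀ {A B} {f : A ⇒ B} → f ∘ id ≈ f

module _ {o ℓ e} (C : Category o ℓ e) where
  open Category C

  record Iso (A B : Obj) : Set (ℓ ⊔ e) where
    field
      from    : A ⇒ B
      to      : B ⇒ A
      isoˡ    : to ∘ from ≈ id
      isoʳ    : from ∘ to ≈ id

  record Dagger : Set (o ⊔ ℓ ⊔ e) where
    field
      _†         : ∀ {A B} → A ⇒ B → B ⇒ A
      †-resp-≈   : ∀ {A B} {f g : A ⇒ B} → f ≈ g → f † ≈ g †
      †-identity : ∀ {A} → (id {A}) † ≈ id
      †-homomorphism : ∀ {A B C} {f : A ⇒ B} {g : B ⇒ C} →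
                       (g ∘ f) † ≈ f † ∘ g †
      †-involutive   : ∀ {A B} {f : A ⇒ B} → (f †) † ≈ f

  record ZeroObject : Set (o ⊔ ℓ ⊔ e) where
    field
      𝟎      : Obj
      !      : ∀ {A} → A ⇒ 𝟎
      ¡      : ∀ {A} → 𝟎 ⇒ A
      !-unique : ∀ {A} (f : A ⇒ 𝟎) → f ≈ !
      ¡-unique : ∀ {A} (f : 𝟎 ⇒ A) → f ≈ ¡

  module WithZero (Z : ZeroObject) where
    open ZeroObject Z

    zero⇒ : ∀ {A B} → A ⇒ B
    zero⇒ = ¡ ∘ !

    -- k : K → X is a kernel of f : X → Y, i.e. an equaliser of f and 0
    record IsKernel {K X Y : Obj} (f : X ⇒ Y) (k : K ⇒ X) : Set (o ⊔ ℓ ⊔ e) where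
      field
        equality  : f ∘ k ≈ zero⇒ ∘ k
        factor    : ∀ {W} (g : W ⇒ X) → f ∘ g ≈ zero⇒ ∘ g → W ⇒ K
        factor-eq : ∀ {W} (g : W ⇒ X) (p : f ∘ g ≈ zero⇒ ∘ g) → k ∘ factor g p ≈ g
        factor-unique : ∀ {W} (g : W ⇒ X) (p : f ∘ g ≈ zero⇒ ∘ g) (u : W ⇒ K) →
                        k ∘ u ≈ g → u ≈ factor g p

    IsZeroEpi : ∀ {A B} → A ⇒ B → Set (o ⊔ ℓ ⊔ e)
    IsZeroEpi {A} {B} f = ∀ {W} (g : B ⇒ W) → g ∘ f ≈ zero⇒ → g ≈ zero⇒

    record Biproduct (A B : Obj) : Set (o ⊔ ℓ ⊔ e) where
      field
        A⊕B : Obj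
        π₁ : A⊕B ⇒ A
        π₂ : A⊕B ⇒ B
        κ₁ : A ⇒ A⊕B
        κ₂ : B ⇒ A⊕B
        ⟨_,_⟩ : ∀ {W} → W ⇒ A → W ⇒ B → W ⇒ A⊕B
        project₁ : ∀ {W} {f : W ⇒ A} {g : W ⇒ B} → π₁ ∘ ⟨ f , g ⟩ ≈ f
        project₂ : ∀ {W} {f : W ⇒ A} {g : W ⇒ B} → π₂ ∘ ⟨ f , g ⟩ ≈ g
        ⟨⟩-unique : ∀ {W} {f : W ⇒ A} {g : W ⇒ B} (h : W ⇒ A⊕B) →
                    π₁ ∘ h ≈ f → π₂ ∘ h ≈ g → h ≈ ⟨ f , g ⟩
        [_,_] : ∀ {W} → A ⇒ W → B ⇒ W → A⊕B ⇒ W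
        inject₁ : ∀ {W} {f : A ⇒ W} {g : B ⇒ W} → [ f , g ] ∘ κ₁ ≈ f
        inject₂ : ∀ {W} {f : A ⇒ W} {g : B ⇒ W} → [ f , g ] ∘ κ₂ ≈ g
        []-unique : ∀ {W} {f : A ⇒ W} {g : B ⇒ W} (h : A⊕B ⇒ W) →
                    h ∘ κ₁ ≈ f → h ∘ κ₂ ≈ g → h ≈ [ f , g ]
        π₁κ₁ : π₁ ∘ κ₁ ≈ id
        π₂κ₂ : π₂ ∘ κ₂ ≈ id
        π₁κ₂ : π₁ ∘ κ₂ ≈ zero⇒
        π₂κ₁ : π₂ ∘ κ₁ ≈ zero⇒

record DaggerKernelCategoryWithComplementedBiproducts (o ℓ e : Level)
       : Set (suc (o ⊔ ℓ ⊔ e)) where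
  field
    cat    : Category o ℓ e
    dagger : Dagger cat
    zeroObj : ZeroObject cat
  open Category cat
  open Dagger dagger
  open WithZero cat zeroObj
  field
    kernel : ∀ {X Y} (f : X ⇒ Y) →
             Σ[ K ∈ Obj ] Σ[ k ∈ K ⇒ X ] (IsKernel f k × (k † ∘ k ≈ id))
    -- finite dagger-biproducts (nullary: the zero object; binary: below)
    biproduct : (A B : Obj) → Biproduct A B
    †-κ₁ : ∀ {A B} → Biproduct.κ₁ (biproduct A B) † ≈ Biproduct.π₁ (biproduct A B)
    †-κ₂ : ∀ {A B} → Biproduct.κ₂ (biproduct A B) † ≈ Biproduct.π₂ (biproduct A B)

  IsDaggerKernel : ∀ {K Y} → K ⇒ Y → Set (o ⊔ ℓ ⊔ e)
  IsDaggerKernel {K} {Y} k =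
    (k † ∘ k ≈ id) × (Σ[ Z ∈ Obj ] Σ[ f ∈ Y ⇒ Z ] IsKernel f k)

  _⊕_ : Obj → Obj → Obj
  A ⊕ B = Biproduct.A⊕B (biproduct A B)

  field
    complemented : ∀ {X Y} (k : X ⇒ Y) → IsDaggerKernel k →
      Σ[ X̄ ∈ Obj ] Σ[ φ ∈ Iso cat Y (X ⊕ X̄) ]
        (Iso.from φ ∘ k ≈ Biproduct.κ₁ (biproduct X X̄))

  _⊕₁_ : ∀ {A B C D} → A ⇒ C → B ⇒ D → (A ⊕ B) ⇒ (C ⊕ D)
  _⊕₁_ {A} {B} {C} {D} f g =
    Biproduct.⟨_,_⟩ (biproduct C D) (f ∘ Biproduct.π₁ (biproduct A B))
                                    (g ∘ Biproduct.π₂ (biproduct A B))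

  IsNormal : ∀ {X} → X ⇒ X → Set e
  IsNormal f = f † ∘ f ≈ f ∘ f †

module Submission where

open import Defs
open import Data.Product using (Σ; Σ-syntax; _×_; _,_; proj₁)
open import Relation.Binary using (IsEquivalence; Setoid)
import Relation.Binary.Reasoning.Setoid as SetoidReasoning

-- Let k = ker f and m = ker k† (the image of f).  Normality makes f and f†
-- kill the same morphisms, so f = m ∘ f₁ ∘ m† with f₁ = m† ∘ f ∘ m, and f₁
-- is zero-epi because the image meets ker f trivially.  With n = ker m†,
-- complementation and the commutative-monoid enrichment induced by the
-- biproducts show that m and n are jointly epic, so ⟨ m† , n† ⟩ : X → M ⊕ L
-- is an isomorphism with inverse [ m , n ], and conjugating f₁ ⊕ 0 by it
-- gives back f.

module HomReasoning {o ℓ e} (𝒞 : Category o ℓ e) where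
  open Category 𝒞

  module ≈ {A B : Obj} = IsEquivalence (≈-equiv {A} {B})

  hom-setoid : Obj → Obj → Setoid ℓ e
  hom-setoid A B = record { Carrier = A ⇒ B ; _≈_ = _≈_ ; isEquivalence = ≈-equiv }

  module ≈-Reasoning {A B : Obj} = SetoidReasoning (hom-setoid A B)

  infixr 4 _⟩∘⟨_ refl⟩∘⟨_
  infixl 5 _⟩∘⟨refl

  _⟩∘⟨_ : ∀ {A B C} {f h : B ⇒ C} {g i : A ⇒ B} → f ≈ h → g ≈ i → f ∘ g ≈ h ∘ i
  _⟩∘⟨_ = ∘-resp-≈

  refl⟩∘⟨_ : ∀ {A B C} {f : B ⇒ C} {g i : A ⇒ B} → g ≈ i → f ∘ g ≈ f ∘ i
  refl⟩∘⟨ p = ≈.refl ⟩∘⟨ p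

  _⟩∘⟨refl : ∀ {A B C} {f h : B ⇒ C} {g : A ⇒ B} → f ≈ h → f ∘ g ≈ h ∘ g
  p ⟩∘⟨refl = p ⟩∘⟨ ≈.refl

  sym-assoc : ∀ {A B C D} {f : A ⇒ B} {g : B ⇒ C} {h : C ⇒ D} →
              h ∘ (g ∘ f) ≈ (h ∘ g) ∘ f
  sym-assoc = ≈.sym assoc

module ZeroMorphisms {o ℓ e} (𝒞 : Category o ℓ e) (Z : ZeroObject 𝒞) where
  open Category 𝒞
  open HomReasoning 𝒞
  open ZeroObject Z
  open WithZero 𝒞 Z

  zero-∘ : ∀ {A B C} {f : A ⇒ B} → zero⇒ {B} {C} ∘ f ≈ zero⇒
  zero-∘ {f = f} = ≈.trans assoc (refl⟩∘⟨ !-unique (! ∘ f))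

  ∘-zero : ∀ {A B C} {f : B ⇒ C} → f ∘ zero⇒ {A} {B} ≈ zero⇒
  ∘-zero {f = f} = ≈.trans sym-assoc (¡-unique (f ∘ ¡) ⟩∘⟨refl)

  kernel-kills : ∀ {K X Y} {f : X ⇒ Y} {k : K ⇒ X} → IsKernel f k → f ∘ k ≈ zero⇒
  kernel-kills k-ker = ≈.trans (IsKernel.equality k-ker) zero-∘

module BiproductLaws {o ℓ e} (𝒞 : Category o ℓ e) (Z : ZeroObject 𝒞)
                     {A B : Category.Obj 𝒞} (S : WithZero.Biproduct 𝒞 Z A B) where
  open Category 𝒞
  open HomReasoning 𝒞
  open WithZero 𝒞 Z
  open ZeroMorphisms 𝒞 Z
  open Biproduct S

  ⟨⟩-∘ : ∀ {V W} {f : W ⇒ A} {g : W ⇒ B} {h : V ⇒ W} → ⟨ f , g ⟩ ∘ h ≈ ⟨ f ∘ h , g ∘ h ⟩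
  ⟨⟩-∘ = ⟨⟩-unique _ (≈.trans sym-assoc (project₁ ⟩∘⟨refl))
                     (≈.trans sym-assoc (project₂ ⟩∘⟨refl))

  ∘-[] : ∀ {V W} {f : A ⇒ W} {g : B ⇒ W} {h : W ⇒ V} → h ∘ [ f , g ] ≈ [ h ∘ f , h ∘ g ]
  ∘-[] = []-unique _ (≈.trans assoc (refl⟩∘⟨ inject₁)) (≈.trans assoc (refl⟩∘⟨ inject₂))

  ⟨⟩-cong₂ : ∀ {W} {f f′ : W ⇒ A} {g g′ : W ⇒ B} → f ≈ f′ → g ≈ g′ → ⟨ f , g ⟩ ≈ ⟨ f′ , g′ ⟩
  ⟨⟩-cong₂ p q = ⟨⟩-unique _ (≈.trans project₁ p) (≈.trans project₂ q)

  []-cong₂ : ∀ {W} {f f′ : A ⇒ W} {g g′ : B ⇒ W} → f ≈ f′ → g ≈ g′ → [ f , g ] ≈ [ f′ , g′ ]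
  []-cong₂ p q = []-unique _ (≈.trans inject₁ p) (≈.trans inject₂ q)

  ⟨-,0⟩ : ∀ {W} {a : W ⇒ A} → ⟨ a , zero⇒ ⟩ ≈ κ₁ ∘ a
  ⟨-,0⟩ = ≈.sym (⟨⟩-unique _ (≈.trans sym-assoc (≈.trans (π₁κ₁ ⟩∘⟨refl) identityˡ))
                             (≈.trans sym-assoc (≈.trans (π₂κ₁ ⟩∘⟨refl) zero-∘)))

  ⟨0,-⟩ : ∀ {W} {b : W ⇒ B} → ⟨ zero⇒ , b ⟩ ≈ κ₂ ∘ b
  ⟨0,-⟩ = ≈.sym (⟨⟩-unique _ (≈.trans sym-assoc (≈.trans (π₁κ₂ ⟩∘⟨refl) zero-∘))
                             (≈.trans sym-assoc (≈.trans (π₂κ₂ ⟩∘⟨refl) identityˡ)))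

  ⟨id,0⟩ : ⟨ id , zero⇒ ⟩ ≈ κ₁
  ⟨id,0⟩ = ≈.trans ⟨-,0⟩ identityʳ

  ⟨0,id⟩ : ⟨ zero⇒ , id ⟩ ≈ κ₂
  ⟨0,id⟩ = ≈.trans ⟨0,-⟩ identityʳ

  [κ₁,κ₂] : [ κ₁ , κ₂ ] ≈ id
  [κ₁,κ₂] = ≈.sym ([]-unique id identityˡ identityˡ)

module BiproductMaps {o ℓ e} (𝒞 : Category o ℓ e) (Z : ZeroObject 𝒞)
                     {A B C D : Category.Obj 𝒞}
                     (S : WithZero.Biproduct 𝒞 Z A B) (T : WithZero.Biproduct 𝒞 Z C D) where
  open Category 𝒞
  open HomReasoning 𝒞
  open WithZero 𝒞 Z
  open ZeroMorphisms 𝒞 Z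
  private
    module S = Biproduct S
    module T = Biproduct T

  ⊕-map : A ⇒ C → B ⇒ D → S.A⊕B ⇒ T.A⊕B
  ⊕-map a b = T.⟨ a ∘ S.π₁ , b ∘ S.π₂ ⟩

  ⊕-map-⟨⟩ : ∀ {W} {a : A ⇒ C} {b : B ⇒ D} {c : W ⇒ A} {d : W ⇒ B} →
             ⊕-map a b ∘ S.⟨ c , d ⟩ ≈ T.⟨ a ∘ c , b ∘ d ⟩
  ⊕-map-⟨⟩ = ≈.trans (BiproductLaws.⟨⟩-∘ 𝒞 Z T)
               (BiproductLaws.⟨⟩-cong₂ 𝒞 Z T (≈.trans assoc (refl⟩∘⟨ S.project₁))
                                              (≈.trans assoc (refl⟩∘⟨ S.project₂)))

  ⊕-map-κ₁ : ∀ {a : A ⇒ C} {b : B ⇒ D} → ⊕-map a b ∘ S.κ₁ ≈ T.κ₁ ∘ a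
  ⊕-map-κ₁ = begin
    ⊕-map _ _ ∘ S.κ₁                 ≈⟨ refl⟩∘⟨ BiproductLaws.⟨id,0⟩ 𝒞 Z S ⟨
    ⊕-map _ _ ∘ S.⟨ id , zero⇒ ⟩      ≈⟨ ⊕-map-⟨⟩ ⟩
    T.⟨ _ ∘ id , _ ∘ zero⇒ ⟩          ≈⟨ BiproductLaws.⟨⟩-cong₂ 𝒞 Z T identityʳ ∘-zero ⟩
    T.⟨ _ , zero⇒ ⟩                   ≈⟨ BiproductLaws.⟨-,0⟩ 𝒞 Z T ⟩
    T.κ₁ ∘ _                         ∎
    where open ≈-Reasoning

  ⊕-map-κ₂ : ∀ {a : A ⇒ C} {b : B ⇒ D} → ⊕-map a b ∘ S.κ₂ ≈ T.κ₂ ∘ b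
  ⊕-map-κ₂ = begin
    ⊕-map _ _ ∘ S.κ₂                 ≈⟨ refl⟩∘⟨ BiproductLaws.⟨0,id⟩ 𝒞 Z S ⟨
    ⊕-map _ _ ∘ S.⟨ zero⇒ , id ⟩      ≈⟨ ⊕-map-⟨⟩ ⟩
    T.⟨ _ ∘ zero⇒ , _ ∘ id ⟩          ≈⟨ BiproductLaws.⟨⟩-cong₂ 𝒞 Z T ∘-zero identityʳ ⟩
    T.⟨ zero⇒ , _ ⟩                   ≈⟨ BiproductLaws.⟨0,-⟩ 𝒞 Z T ⟩
    T.κ₂ ∘ _                         ∎
    where open ≈-Reasoning

module BiproductAddition {o ℓ e} (𝒞 : Category o ℓ e) (Z : ZeroObject 𝒞)
    (biproduct : (A B : Category.Obj 𝒞) → WithZero.Biproduct 𝒞 Z A B) where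
  open Category 𝒞
  open HomReasoning 𝒞
  open WithZero 𝒞 Z
  open ZeroMorphisms 𝒞 Z

  private
    module ⊕ {A B : Obj} = Biproduct (biproduct A B)
    module ⊕-laws {A B : Obj} = BiproductLaws 𝒞 Z (biproduct A B)

  codiagonal : ∀ {Y} → ⊕.A⊕B {Y} {Y} ⇒ Y
  codiagonal = ⊕.[ id , id ]

  infixl 6 _+_
  _+_ : ∀ {W Y} → W ⇒ Y → W ⇒ Y → W ⇒ Y
  f + g = codiagonal ∘ ⊕.⟨ f , g ⟩

  +-cong : ∀ {W Y} {f f′ g g′ : W ⇒ Y} → f ≈ f′ → g ≈ g′ → f + g ≈ f′ + g′
  +-cong p q = refl⟩∘⟨ ⊕-laws.⟨⟩-cong₂ p q

  +-distribʳ : ∀ {V W Y} {f g : W ⇒ Y} {h : V ⇒ W} → (f + g) ∘ h ≈ f ∘ h + g ∘ h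
  +-distribʳ = ≈.trans assoc (refl⟩∘⟨ ⊕-laws.⟨⟩-∘)

  []-via-codiagonal : ∀ {A B Y} (S : Biproduct A B) {a : A ⇒ Y} {b : B ⇒ Y} →
    Biproduct.[_,_] S a b ≈ codiagonal ∘ BiproductMaps.⊕-map 𝒞 Z S (biproduct Y Y) a b
  []-via-codiagonal S = ≈.sym (Biproduct.[]-unique S _ (branch ⊕-maps.⊕-map-κ₁ ⊕.inject₁)
                                                       (branch ⊕-maps.⊕-map-κ₂ ⊕.inject₂))
    where
    module ⊕-maps = BiproductMaps 𝒞 Z S (biproduct _ _)
    branch : ∀ {P R Y} {s : P ⇒ ⊕.A⊕B {Y} {Y}} {κ : R ⇒ P} {t : Y ⇒ ⊕.A⊕B} {a : R ⇒ Y} →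
             s ∘ κ ≈ t ∘ a → codiagonal ∘ t ≈ id → (codiagonal ∘ s) ∘ κ ≈ a
    branch {s = s} {κ} {t} {a} sκ ∇t = begin
      (codiagonal ∘ s) ∘ κ   ≈⟨ assoc ⟩
      codiagonal ∘ (s ∘ κ)   ≈⟨ refl⟩∘⟨ sκ ⟩
      codiagonal ∘ (t ∘ a)   ≈⟨ sym-assoc ⟩
      (codiagonal ∘ t) ∘ a   ≈⟨ ∇t ⟩∘⟨refl ⟩
      id ∘ a                 ≈⟨ identityˡ ⟩
      a                      ∎
      where open ≈-Reasoning

  []∘⟨⟩ : ∀ {A B W Y} (S : Biproduct A B) {a : A ⇒ Y} {b : B ⇒ Y} {c : W ⇒ A} {d : W ⇒ B} →
          Biproduct.[_,_] S a b ∘ Biproduct.⟨_,_⟩ S c d ≈ a ∘ c + b ∘ d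
  []∘⟨⟩ S = ≈.trans ([]-via-codiagonal S ⟩∘⟨refl)
              (≈.trans assoc (refl⟩∘⟨ BiproductMaps.⊕-map-⟨⟩ 𝒞 Z S (biproduct _ _)))

  +-distribˡ : ∀ {W Y V} {f g : W ⇒ Y} {h : Y ⇒ V} → h ∘ (f + g) ≈ h ∘ f + h ∘ g
  +-distribˡ = ≈.trans sym-assoc
                 (≈.trans (≈.trans ⊕-laws.∘-[] (⊕-laws.[]-cong₂ identityʳ identityʳ) ⟩∘⟨refl)
                          ([]∘⟨⟩ (biproduct _ _)))

  +-identityˡ : ∀ {W Y} {f : W ⇒ Y} → zero⇒ + f ≈ f
  +-identityˡ = ≈.trans (refl⟩∘⟨ ⊕-laws.⟨0,-⟩)
                  (≈.trans sym-assoc (≈.trans (⊕.inject₂ ⟩∘⟨refl) identityˡ))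

  +-identityʳ : ∀ {W Y} {f : W ⇒ Y} → f + zero⇒ ≈ f
  +-identityʳ = ≈.trans (refl⟩∘⟨ ⊕-laws.⟨-,0⟩)
                  (≈.trans sym-assoc (≈.trans (⊕.inject₁ ⟩∘⟨refl) identityˡ))

  -- The codiagonal is invariant under the swap ⟨ π₂ , π₁ ⟩ of Y ⊕ Y.
  +-comm : ∀ {W Y} {f g : W ⇒ Y} → f + g ≈ g + f
  +-comm {f = f} {g} = begin
    codiagonal ∘ ⊕.⟨ f , g ⟩                  ≈⟨ ∇-swap ⟩∘⟨refl ⟨
    (codiagonal ∘ swap) ∘ ⊕.⟨ f , g ⟩         ≈⟨ assoc ⟩
    codiagonal ∘ (swap ∘ ⊕.⟨ f , g ⟩)         ≈⟨ refl⟩∘⟨ ⊕-laws.⟨⟩-∘ ⟩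
    codiagonal ∘ ⊕.⟨ ⊕.π₂ ∘ ⊕.⟨ f , g ⟩ , ⊕.π₁ ∘ ⊕.⟨ f , g ⟩ ⟩
      ≈⟨ refl⟩∘⟨ ⊕-laws.⟨⟩-cong₂ ⊕.project₂ ⊕.project₁ ⟩
    codiagonal ∘ ⊕.⟨ g , f ⟩                  ∎
    where
    open ≈-Reasoning
    swap : ⊕.A⊕B ⇒ ⊕.A⊕B
    swap = ⊕.⟨ ⊕.π₂ , ⊕.π₁ ⟩
    swap-κ₁ : swap ∘ ⊕.κ₁ ≈ ⊕.κ₂
    swap-κ₁ = ≈.trans ⊕-laws.⟨⟩-∘ (≈.trans (⊕-laws.⟨⟩-cong₂ ⊕.π₂κ₁ ⊕.π₁κ₁) ⊕-laws.⟨0,id⟩)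
    swap-κ₂ : swap ∘ ⊕.κ₂ ≈ ⊕.κ₁
    swap-κ₂ = ≈.trans ⊕-laws.⟨⟩-∘ (≈.trans (⊕-laws.⟨⟩-cong₂ ⊕.π₂κ₂ ⊕.π₁κ₂) ⊕-laws.⟨id,0⟩)
    ∇-swap : codiagonal ∘ swap ≈ codiagonal
    ∇-swap = ⊕.[]-unique _ (≈.trans assoc (≈.trans (refl⟩∘⟨ swap-κ₁) ⊕.inject₂))
                           (≈.trans assoc (≈.trans (refl⟩∘⟨ swap-κ₂) ⊕.inject₁))

  -- Evaluating [ f + g , h ] and [ f , h ] + [ g , 0 ] on the diagonal of W ⊕ W.
  +-swapʳ : ∀ {W Y} {f g h : W ⇒ Y} → (f + g) + h ≈ (f + h) + g
  +-swapʳ {f = f} {g} {h} = begin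
    (f + g) + h                               ≈⟨ +-cong identityʳ identityʳ ⟨
    (f + g) ∘ id + h ∘ id                     ≈⟨ []∘⟨⟩ (biproduct _ _) ⟨
    ⊕.[ f + g , h ] ∘ Δ                       ≈⟨ split ⟩∘⟨refl ⟩
    (⊕.[ f , h ] + ⊕.[ g , zero⇒ ]) ∘ Δ       ≈⟨ +-distribʳ ⟩
    ⊕.[ f , h ] ∘ Δ + ⊕.[ g , zero⇒ ] ∘ Δ     ≈⟨ +-cong ([]∘⟨⟩ (biproduct _ _)) ([]∘⟨⟩ (biproduct _ _)) ⟩
    (f ∘ id + h ∘ id) + (g ∘ id + zero⇒ ∘ id)
      ≈⟨ +-cong (+-cong identityʳ identityʳ) (≈.trans (+-cong identityʳ zero-∘) +-identityʳ) ⟩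
    (f + h) + g                               ∎
    where
    open ≈-Reasoning
    Δ = ⊕.⟨ id , id ⟩
    split : ⊕.[ f + g , h ] ≈ ⊕.[ f , h ] + ⊕.[ g , zero⇒ ]
    split = ≈.sym (⊕.[]-unique _ (≈.trans +-distribʳ (+-cong ⊕.inject₁ ⊕.inject₁))
                                 (≈.trans +-distribʳ (≈.trans (+-cong ⊕.inject₂ ⊕.inject₂) +-identityʳ)))

  +-assoc : ∀ {W Y} {f g h : W ⇒ Y} → f + (g + h) ≈ (f + g) + h
  +-assoc = ≈.trans +-comm (≈.trans +-swapʳ (+-cong +-comm ≈.refl))

module DaggerZero {o ℓ e} (𝒞 : Category o ℓ e) (D : Dagger 𝒞) (Z : ZeroObject 𝒞) where
  open Category 𝒞
  open HomReasoning 𝒞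
  open Dagger D
  open ZeroObject Z
  open WithZero 𝒞 Z
  open ZeroMorphisms 𝒞 Z

  †-zero : ∀ {A B} → zero⇒ {A} {B} † ≈ zero⇒
  †-zero = ≈.trans †-homomorphism (¡-unique _ ⟩∘⟨ !-unique _)

  †-kills : ∀ {A B C} {g : B ⇒ C} {h : A ⇒ B} → g ∘ h ≈ zero⇒ → h † ∘ g † ≈ zero⇒
  †-kills p = ≈.trans (≈.sym †-homomorphism) (≈.trans (†-resp-≈ p) †-zero)

  †-reflects-zero : ∀ {A B} {g : A ⇒ B} → g † ≈ zero⇒ → g ≈ zero⇒
  †-reflects-zero p = ≈.trans (≈.sym †-involutive) (≈.trans (†-resp-≈ p) †-zero)

  dagger-mono-cancels-zero : ∀ {A B W} {m : A ⇒ B} {x : W ⇒ A} →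
                             m † ∘ m ≈ id → m ∘ x ≈ zero⇒ → x ≈ zero⇒
  dagger-mono-cancels-zero {m = m} {x} m-iso p = begin
    x                ≈⟨ identityˡ ⟨
    id ∘ x           ≈⟨ m-iso ⟩∘⟨refl ⟨
    (m † ∘ m) ∘ x    ≈⟨ assoc ⟩
    m † ∘ (m ∘ x)    ≈⟨ refl⟩∘⟨ p ⟩
    m † ∘ zero⇒      ≈⟨ ∘-zero ⟩
    zero⇒            ∎
    where open ≈-Reasoning

  kernel-projection : ∀ {K X Y W} {f : X ⇒ Y} {k : K ⇒ X} → IsKernel f k → k † ∘ k ≈ id →
                      (g : W ⇒ X) → f ∘ g ≈ zero⇒ → k ∘ (k † ∘ g) ≈ g
  kernel-projection {k = k} k-ker k-iso g fg = begin
    k ∘ (k † ∘ g)          ≈⟨ refl⟩∘⟨ refl⟩∘⟨ factor-eq ⟨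
    k ∘ (k † ∘ (k ∘ u))    ≈⟨ refl⟩∘⟨ sym-assoc ⟩
    k ∘ ((k † ∘ k) ∘ u)    ≈⟨ refl⟩∘⟨ (k-iso ⟩∘⟨refl) ⟩
    k ∘ (id ∘ u)           ≈⟨ refl⟩∘⟨ identityˡ ⟩
    k ∘ u                  ≈⟨ factor-eq ⟩
    g                      ∎
    where
    open ≈-Reasoning
    fg′ = ≈.trans fg (≈.sym zero-∘)
    u = IsKernel.factor k-ker g fg′
    factor-eq = IsKernel.factor-eq k-ker g fg′

module _ {o ℓ e} (𝒜 : DaggerKernelCategoryWithComplementedBiproducts o ℓ e) where
  open DaggerKernelCategoryWithComplementedBiproducts 𝒜
  open Category cat
  open HomReasoning cat
  open Dagger dagger
  open WithZero cat zeroObj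
  open ZeroMorphisms cat zeroObj
  open DaggerZero cat dagger zeroObj
  open BiproductAddition cat zeroObj biproduct

  -- f and f† ∘ f kill the same morphisms: factor f ∘ y through ker f†.
  †-cancel-zero : ∀ {X Y W} (f : X ⇒ Y) (y : W ⇒ X) →
                  f † ∘ (f ∘ y) ≈ zero⇒ → f ∘ y ≈ zero⇒
  †-cancel-zero f y p with kernel (f †)
  ... | (_ , l , l-ker , l-iso) = begin
    f ∘ y                   ≈⟨ kernel-projection l-ker l-iso (f ∘ y) p ⟨
    l ∘ (l † ∘ (f ∘ y))     ≈⟨ refl⟩∘⟨ sym-assoc ⟩
    l ∘ ((l † ∘ f) ∘ y)     ≈⟨ refl⟩∘⟨ (l†f ⟩∘⟨refl) ⟩
    l ∘ (zero⇒ ∘ y)         ≈⟨ refl⟩∘⟨ zero-∘ ⟩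
    l ∘ zero⇒               ≈⟨ ∘-zero ⟩
    zero⇒                   ∎
    where
    open ≈-Reasoning
    l†f : l † ∘ f ≈ zero⇒
    l†f = ≈.trans (refl⟩∘⟨ ≈.sym †-involutive) (†-kills (kernel-kills l-ker))

  module _ {X} {f : X ⇒ X} (normal : IsNormal f) where

    normal-kills-† : ∀ {W} {y : W ⇒ X} → f ∘ y ≈ zero⇒ → f † ∘ y ≈ zero⇒
    normal-kills-† {y = y} fy = †-cancel-zero (f †) y (begin
      f † † ∘ (f † ∘ y)   ≈⟨ †-involutive ⟩∘⟨refl ⟩
      f ∘ (f † ∘ y)       ≈⟨ sym-assoc ⟩
      (f ∘ f †) ∘ y       ≈⟨ normal ⟩∘⟨refl ⟨
      (f † ∘ f) ∘ y       ≈⟨ assoc ⟩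
      f † ∘ (f ∘ y)       ≈⟨ refl⟩∘⟨ fy ⟩
      f † ∘ zero⇒         ≈⟨ ∘-zero ⟩
      zero⇒               ∎)
      where open ≈-Reasoning

    normal-kills-from-† : ∀ {W} {y : W ⇒ X} → f † ∘ y ≈ zero⇒ → f ∘ y ≈ zero⇒
    normal-kills-from-† {y = y} f†y = †-cancel-zero f y (begin
      f † ∘ (f ∘ y)       ≈⟨ sym-assoc ⟩
      (f † ∘ f) ∘ y       ≈⟨ normal ⟩∘⟨refl ⟩
      (f ∘ f †) ∘ y       ≈⟨ assoc ⟩
      f ∘ (f † ∘ y)       ≈⟨ refl⟩∘⟨ f†y ⟩
      f ∘ zero⇒           ≈⟨ ∘-zero ⟩
      zero⇒               ∎)
      where open ≈-Reasoning

  module OrthogonalDecomposition {M L X} (m : M ⇒ X) (m-dagger-kernel : IsDaggerKernel m)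
                                 (n : L ⇒ X) (n-ker : IsKernel (m †) n) (n-iso : n † ∘ n ≈ id) where
    private
      module M⊕L = Biproduct (biproduct M L)
      module M⊕L-laws = BiproductLaws cat zeroObj (biproduct M L)
      module M⊕L-maps = BiproductMaps cat zeroObj (biproduct M L) (biproduct M L)
      m-iso : m † ∘ m ≈ id
      m-iso = proj₁ m-dagger-kernel

    m†n : m † ∘ n ≈ zero⇒
    m†n = kernel-kills n-ker

    n†m : n † ∘ m ≈ zero⇒
    n†m = ≈.trans (refl⟩∘⟨ ≈.sym †-involutive) (†-kills m†n)

    -- The
    -- complement X ≅ M ⊕ M̄ gives id = m ∘ q + d ∘ s with s ∘ m = 0; then s
    -- factors through n, and d ∘ s ∘ n is rewritten as m ∘ c + n.
    resolution-of-identity : Σ[ q ∈ X ⇒ M ] Σ[ c ∈ L ⇒ M ] (id ≈ m ∘ q + (m ∘ c + n) ∘ n †)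
    resolution-of-identity with complemented m m-dagger-kernel
    ... | (M̄ , ρ , ρm) = q , c , (begin
      id                          ≈⟨ id-split ⟩
      m ∘ q + d ∘ s               ≈⟨ +-cong ≈.refl (refl⟩∘⟨ s-through-n) ⟩
      m ∘ q + d ∘ (b ∘ n †)       ≈⟨ +-cong ≈.refl sym-assoc ⟩
      m ∘ q + (d ∘ b) ∘ n †       ≈⟨ +-cong ≈.refl (db-split ⟩∘⟨refl) ⟩
      m ∘ q + (m ∘ c + n) ∘ n †   ∎)
      where
      open ≈-Reasoning
      module M⊕M̄ = Biproduct (biproduct M M̄)
      module ρ = Iso ρ
      q : X ⇒ M
      q = M⊕M̄.π₁ ∘ ρ.from
      s : X ⇒ M̄
      s = M⊕M̄.π₂ ∘ ρ.from
      d : M̄ ⇒ X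
      d = ρ.to ∘ M⊕M̄.κ₂
      a : L ⇒ M
      a = q ∘ n
      b : L ⇒ M̄
      b = s ∘ n
      c : L ⇒ M
      c = m † ∘ (d ∘ b)

      to-κ₁ : ρ.to ∘ M⊕M̄.κ₁ ≈ m
      to-κ₁ = ≈.trans (refl⟩∘⟨ ≈.sym ρm)
                (≈.trans sym-assoc (≈.trans (ρ.isoˡ ⟩∘⟨refl) identityˡ))

      id-split : id ≈ m ∘ q + d ∘ s
      id-split = ≈.trans (≈.sym ρ.isoˡ)
        (≈.trans (M⊕M̄.[]-unique ρ.to to-κ₁ ≈.refl ⟩∘⟨ M⊕M̄.⟨⟩-unique ρ.from ≈.refl ≈.refl)
                 ([]∘⟨⟩ (biproduct M M̄)))

      -- s ∘ m = 0, so s† is killed by m† and factors through n = ker m†.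
      s-through-n : s ≈ b ∘ n †
      s-through-n = begin
        s                     ≈⟨ †-involutive ⟨
        s † †                 ≈⟨ †-resp-≈ (kernel-projection n-ker n-iso (s †) (†-kills sm)) ⟨
        (n ∘ (n † ∘ s †)) †   ≈⟨ †-homomorphism ⟩
        (n † ∘ s †) † ∘ n †   ≈⟨ ≈.trans †-homomorphism (†-involutive ⟩∘⟨ †-involutive) ⟩∘⟨refl ⟩
        (s ∘ n) ∘ n †         ∎
        where
        sm : s ∘ m ≈ zero⇒
        sm = ≈.trans assoc (≈.trans (refl⟩∘⟨ ρm) M⊕M̄.π₂κ₁)

      n-split : n ≈ m ∘ a + d ∘ b
      n-split = ≈.trans (≈.sym identityˡ)
                  (≈.trans (id-split ⟩∘⟨refl) (≈.trans +-distribʳ (+-cong assoc assoc)))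

      -- Applying m† to n-split: 0 = a + c.
      c+a≈0 : c + a ≈ zero⇒
      c+a≈0 = begin
        c + a                           ≈⟨ +-comm ⟩
        a + c                           ≈⟨ +-cong m†m-cancel ≈.refl ⟨
        m † ∘ (m ∘ a) + m † ∘ (d ∘ b)   ≈⟨ +-distribˡ ⟨
        m † ∘ (m ∘ a + d ∘ b)           ≈⟨ refl⟩∘⟨ n-split ⟨
        m † ∘ n                         ≈⟨ m†n ⟩
        zero⇒                           ∎
        where
        m†m-cancel : m † ∘ (m ∘ a) ≈ a
        m†m-cancel = ≈.trans sym-assoc (≈.trans (m-iso ⟩∘⟨refl) identityˡ)

      db-split : d ∘ b ≈ m ∘ c + n
      db-split = ≈.sym (begin
        m ∘ c + n                 ≈⟨ +-cong ≈.refl n-split ⟩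
        m ∘ c + (m ∘ a + d ∘ b)   ≈⟨ +-assoc ⟩
        (m ∘ c + m ∘ a) + d ∘ b   ≈⟨ +-cong +-distribˡ ≈.refl ⟨
        m ∘ (c + a) + d ∘ b       ≈⟨ +-cong (refl⟩∘⟨ c+a≈0) ≈.refl ⟩
        m ∘ zero⇒ + d ∘ b         ≈⟨ +-cong ∘-zero ≈.refl ⟩
        zero⇒ + d ∘ b             ≈⟨ +-identityˡ ⟩
        d ∘ b                     ∎)

    -- m and n are jointly epic: expand u = u ∘ id by the resolution of identity.
    jointly-epic : ∀ {W} {u v : X ⇒ W} → u ∘ m ≈ v ∘ m → u ∘ n ≈ v ∘ n → u ≈ v
    jointly-epic {W} {u} {v} um un with resolution-of-identity
    ... | (q , c , id-resolved) = begin
      u                                          ≈⟨ expand u ⟩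
      (u ∘ m) ∘ q + ((u ∘ m) ∘ c + u ∘ n) ∘ n †  ≈⟨ +-cong (um ⟩∘⟨refl) (+-cong (um ⟩∘⟨refl) un ⟩∘⟨refl) ⟩
      (v ∘ m) ∘ q + ((v ∘ m) ∘ c + v ∘ n) ∘ n †  ≈⟨ expand v ⟨
      v                                          ∎
      where
      open ≈-Reasoning
      expand : ∀ (w : X ⇒ W) → w ≈ (w ∘ m) ∘ q + ((w ∘ m) ∘ c + w ∘ n) ∘ n †
      expand w = begin
        w                                          ≈⟨ identityʳ ⟨
        w ∘ id                                     ≈⟨ refl⟩∘⟨ id-resolved ⟩
        w ∘ (m ∘ q + (m ∘ c + n) ∘ n †)            ≈⟨ +-distribˡ ⟩
        w ∘ (m ∘ q) + w ∘ ((m ∘ c + n) ∘ n †)      ≈⟨ +-cong sym-assoc (≈.trans sym-assoc (+-distribˡ ⟩∘⟨refl)) ⟩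
        (w ∘ m) ∘ q + (w ∘ (m ∘ c) + w ∘ n) ∘ n †  ≈⟨ +-cong ≈.refl (+-cong sym-assoc ≈.refl ⟩∘⟨refl) ⟩
        (w ∘ m) ∘ q + ((w ∘ m) ∘ c + w ∘ n) ∘ n †  ∎

    from-m : M⊕L.⟨ m † , n † ⟩ ∘ m ≈ M⊕L.κ₁
    from-m = ≈.trans M⊕L-laws.⟨⟩-∘ (≈.trans (M⊕L-laws.⟨⟩-cong₂ m-iso n†m) M⊕L-laws.⟨id,0⟩)

    from-n : M⊕L.⟨ m † , n † ⟩ ∘ n ≈ M⊕L.κ₂
    from-n = ≈.trans M⊕L-laws.⟨⟩-∘ (≈.trans (M⊕L-laws.⟨⟩-cong₂ m†n n-iso) M⊕L-laws.⟨0,id⟩)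

    orthogonal-iso : Iso cat X (M ⊕ L)
    orthogonal-iso = record
      { from = M⊕L.⟨ m † , n † ⟩
      ; to   = M⊕L.[ m , n ]
      ; isoˡ = jointly-epic (section-on from-m M⊕L.inject₁) (section-on from-n M⊕L.inject₂)
      ; isoʳ = ≈.trans M⊕L-laws.∘-[] (≈.trans (M⊕L-laws.[]-cong₂ from-m from-n) M⊕L-laws.[κ₁,κ₂])
      }
      where
      section-on : ∀ {A} {x : A ⇒ X} {κ : A ⇒ (M ⊕ L)} → M⊕L.⟨ m † , n † ⟩ ∘ x ≈ κ →
                   M⊕L.[ m , n ] ∘ κ ≈ x → (M⊕L.[ m , n ] ∘ M⊕L.⟨ m † , n † ⟩) ∘ x ≈ id ∘ x
      section-on from-x to-κ =
        ≈.trans assoc (≈.trans (refl⟩∘⟨ from-x) (≈.trans to-κ (≈.sym identityˡ)))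

    block-diagonal : (h : M ⇒ M) →
      m ∘ (h ∘ m †) ≈ Iso.to orthogonal-iso ∘ ((h ⊕₁ zero⇒ {L} {L}) ∘ Iso.from orthogonal-iso)
    block-diagonal h = begin
      m ∘ (h ∘ m †)                                  ≈⟨ M⊕L.inject₁ ⟩∘⟨refl ⟨
      (M⊕L.[ m , n ] ∘ M⊕L.κ₁) ∘ (h ∘ m †)           ≈⟨ assoc ⟩
      M⊕L.[ m , n ] ∘ (M⊕L.κ₁ ∘ (h ∘ m †))           ≈⟨ refl⟩∘⟨ M⊕L-laws.⟨-,0⟩ ⟨
      M⊕L.[ m , n ] ∘ M⊕L.⟨ h ∘ m † , zero⇒ ⟩         ≈⟨ refl⟩∘⟨ M⊕L-laws.⟨⟩-cong₂ ≈.refl zero-∘ ⟨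
      M⊕L.[ m , n ] ∘ M⊕L.⟨ h ∘ m † , zero⇒ ∘ n † ⟩   ≈⟨ refl⟩∘⟨ M⊕L-maps.⊕-map-⟨⟩ ⟨
      M⊕L.[ m , n ] ∘ ((h ⊕₁ zero⇒) ∘ M⊕L.⟨ m † , n † ⟩) ∎
      where open ≈-Reasoning

  module NormalImage {X K M} {f : X ⇒ X} (normal : IsNormal f)
                     {k : K ⇒ X} (k-ker : IsKernel f k) (k-iso : k † ∘ k ≈ id)
                     {m : M ⇒ X} (m-ker : IsKernel (k †) m) (m-iso : m † ∘ m ≈ id) where

    restriction : M ⇒ M
    restriction = m † ∘ (f ∘ m)

    -- f† ∘ k = 0 by normality, hence k† ∘ f = 0 and f factors through m.
    image-factors : m ∘ (m † ∘ f) ≈ f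
    image-factors = kernel-projection m-ker m-iso f k†f
      where
      k†f : k † ∘ f ≈ zero⇒
      k†f = ≈.trans (refl⟩∘⟨ ≈.sym †-involutive)
                    (†-kills (normal-kills-† normal (kernel-kills k-ker)))

    -- f ∘ k = 0, hence k† ∘ f† = 0, so f† factors through m; taking daggers,
    -- f factors through m†.
    coimage-factors : (f ∘ m) ∘ m † ≈ f
    coimage-factors = begin
      (f ∘ m) ∘ m †                ≈⟨ (†-involutive ⟩∘⟨ †-involutive) ⟩∘⟨refl ⟨
      (f † † ∘ m † †) ∘ m †        ≈⟨ †-homomorphism ⟩∘⟨refl ⟨
      (m † ∘ f †) † ∘ m †          ≈⟨ †-homomorphism ⟨
      (m ∘ (m † ∘ f †)) †          ≈⟨ †-resp-≈ (kernel-projection m-ker m-iso (f †) (†-kills (kernel-kills k-ker))) ⟩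
      f † †                        ≈⟨ †-involutive ⟩
      f                            ∎
      where open ≈-Reasoning

    factorisation : f ≈ m ∘ (restriction ∘ m †)
    factorisation = begin
      f                                 ≈⟨ image-factors ⟨
      m ∘ (m † ∘ f)                     ≈⟨ refl⟩∘⟨ refl⟩∘⟨ coimage-factors ⟨
      m ∘ (m † ∘ ((f ∘ m) ∘ m †))       ≈⟨ refl⟩∘⟨ sym-assoc ⟩
      m ∘ (restriction ∘ m †)           ∎
      where open ≈-Reasoning

    -- The image meets the kernel trivially: anything through m that f kills
    -- lies in ker f = k and is therefore killed by k† ∘ m = 0.
    image-meets-kernel-trivially : ∀ {W} {x : W ⇒ M} → f ∘ (m ∘ x) ≈ zero⇒ → x ≈ zero⇒
    image-meets-kernel-trivially {x = x} fmx = dagger-mono-cancels-zero m-iso (begin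
      m ∘ x                  ≈⟨ kernel-projection k-ker k-iso (m ∘ x) fmx ⟨
      k ∘ (k † ∘ (m ∘ x))    ≈⟨ refl⟩∘⟨ sym-assoc ⟩
      k ∘ ((k † ∘ m) ∘ x)    ≈⟨ refl⟩∘⟨ (kernel-kills m-ker ⟩∘⟨refl) ⟩
      k ∘ (zero⇒ ∘ x)        ≈⟨ refl⟩∘⟨ zero-∘ ⟩
      k ∘ zero⇒              ≈⟨ ∘-zero ⟩
      zero⇒                  ∎)
      where open ≈-Reasoning

    -- If g ∘ f₁ = 0 then g ∘ m† ∘ f = 0; by normality f kills m ∘ g†, so g† = 0.
    restriction-zero-epi : IsZeroEpi restriction
    restriction-zero-epi g g-kills =
      †-reflects-zero (image-meets-kernel-trivially (normal-kills-from-† normal f†mg†))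
      where
      open ≈-Reasoning
      gm†f : (g ∘ m †) ∘ f ≈ zero⇒
      gm†f = begin
        (g ∘ m †) ∘ f                         ≈⟨ refl⟩∘⟨ factorisation ⟩
        (g ∘ m †) ∘ (m ∘ (restriction ∘ m †)) ≈⟨ assoc ⟩
        g ∘ (m † ∘ (m ∘ (restriction ∘ m †))) ≈⟨ refl⟩∘⟨ sym-assoc ⟩
        g ∘ ((m † ∘ m) ∘ (restriction ∘ m †)) ≈⟨ refl⟩∘⟨ (m-iso ⟩∘⟨refl) ⟩
        g ∘ (id ∘ (restriction ∘ m †))        ≈⟨ refl⟩∘⟨ identityˡ ⟩
        g ∘ (restriction ∘ m †)               ≈⟨ sym-assoc ⟩
        (g ∘ restriction) ∘ m †               ≈⟨ g-kills ⟩∘⟨refl ⟩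
        zero⇒ ∘ m †                           ≈⟨ zero-∘ ⟩
        zero⇒                                 ∎
      f†mg† : f † ∘ (m ∘ g †) ≈ zero⇒
      f†mg† = ≈.trans (refl⟩∘⟨ (≈.sym †-involutive ⟩∘⟨refl))
                      (≈.trans (refl⟩∘⟨ ≈.sym †-homomorphism) (†-kills gm†f))

  normal-form : ∀ {X : Obj} (f : X ⇒ X) → IsNormal f →
    Σ[ K ∈ Obj ] Σ[ K̄ ∈ Obj ] Σ[ φ ∈ Iso cat X (K ⊕ K̄) ] Σ[ f₁ ∈ K ⇒ K ]
      (IsZeroEpi f₁ × (f ≈ Iso.to φ ∘ ((f₁ ⊕₁ zero⇒ {K̄} {K̄}) ∘ Iso.from φ)))
  normal-form f normal with kernel f
  ... | (_ , k , k-ker , k-iso) with kernel (k †)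
  ... | (M , m , m-ker , m-iso) with kernel (m †)
  ... | (L , n , n-ker , n-iso) =
    M , L , orthogonal-iso , restriction , restriction-zero-epi ,
    ≈.trans factorisation (block-diagonal restriction)
    where
    open NormalImage normal k-ker k-iso m-ker m-iso
    open OrthogonalDecomposition m (m-iso , (_ , k † , m-ker)) n n-ker n-iso

lemma24 : ∀ {o ℓ e} (𝒜 : DaggerKernelCategoryWithComplementedBiproducts o ℓ e) →
    let open DaggerKernelCategoryWithComplementedBiproducts 𝒜
        open Category cat
        open WithZero cat zeroObj
    in ∀ {X : Obj} (f : X ⇒ X) → IsNormal f →
       Σ[ K ∈ Obj ] Σ[ K̄ ∈ Obj ] Σ[ φ ∈ Iso cat X (K ⊕ K̄) ] Σ[ f₁ ∈ K ⇒ K ]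
         (IsZeroEpi f₁ × (f ≈ Iso.to φ ∘ ((f₁ ⊕₁ zero⇒ {K̄} {K̄}) ∘ Iso.from φ)))
lemma24 𝒜 = normal-form 𝒜
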